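{- The relation $\Rrightarrow$ is strongly confluent in $\lambda\Pi_P$: for all terms $M,M',M''$, if $M\Rrightarrow M'$ and $M\Rrightarrow M''$, then there is a term $N$ with $M'\Rrightarrow N$ and $M''\Rrightarrow N$.
   Context: $P=\langle S,A,R\rangle$ is a functional Pure Type System (sorts $S$, axioms $A\subseteq S\times S$, rules $R\subseteq S\times S\times S$, axioms and rules functional). Terms of $\lambda\Pi_P$: $t::=x\mid Type\mid Kind\mid \Pi x:t~t\mid\lambda x:t~t\mid t~t$, where variables include constants $U_s,\varepsilon_s$ ($s\in S$), $\dot{s_1}$ ($\langle s_1,s_2\rangle\in A$), $\dot\Pi_{\langle s_1,s_2,s_3\rangle}$ ($\langle s_1,s_2,s_3\rangle\in R$). Parallel reduction $\Rrightarrow$ is the smallest relation closed under: ($\alpha$) $M\Rrightarrow M$; ($\beta$) $\varepsilon_{s_2}~\dot{s_1}\Rrightarrow U_{s_1}$ for $\langle s_1,s_2\rangle\in A$; ($\gamma$) $A\Rrightarrow A'$, $M\Rrightarrow M'$ give $\lambda x:A~M\Rrightarrow\lambda x:A'~M'$; ($\delta$) $A\Rrightarrow A'$, $B\Rrightarrow B'$ give $\Pi x:A~B\Rrightarrow \Pi x:A'~B'$; ($\theta_1$) $M\Rrightarrow M'$, $N\Rrightarrow N'$ give $M~N\Rrightarrow M'~N'$; ($\theta_2$) $M\Rrightarrow M'$, $N\Rrightarrow N'$ give $(\lambda x:A~M)~N\Rrightarrow (N'/x)M'$; ($\eta_1$) $A\Rrightarrow A'$, $B\Rrightarrow B'$ give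 $\varepsilon_{s_3}(\dot\Pi_{\langle s_1,s_2,s_3\rangle}~A~B)\Rrightarrow \varepsilon_{s_3}(\dot\Pi_{\langle s_1,s_2,s_3\rangle}~A'~B')$; ($\eta_2$) $A\Rrightarrow A'$, $B\Rrightarrow B'$ give $\varepsilon_{s_3}(\dot\Pi_{\langle s_1,s_2,s_3\rangle}~A~B)\Rrightarrow \Pi x:(\varepsilon_{s_1}~A')~(\varepsilon_{s_2}~(B'~x))$, for $\langle s_1,s_2,s_3\rangle\in R$. -}

module Defs where

open import Level using (Level; _⊔_) renaming (suc to lsuc)
open import Data.Nat using (ℕ; zero; suc)
open import Data.Fin using (Fin; zero; suc)
open import Relation.Binary.PropositionalEquality using (_≡_)

record PTS (ℓ : Level) : Set (lsuc ℓ) where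
  field
    Sort  : Set ℓ
    Axiom : Sort → Sort → Set ℓ
    Rule  : Sort → Sort → Sort → Set ℓ
    axiom-functional : ∀ {s₁ s₂ s₂'} → Axiom s₁ s₂ → Axiom s₁ s₂' → s₂ ≡ s₂'
    rule-functional  : ∀ {s₁ s₂ s₃ s₃'} → Rule s₁ s₂ s₃ → Rule s₁ s₂ s₃' → s₃ ≡ s₃'

module LambdaPi {ℓ : Level} (P : PTS ℓ) where
  open PTS P

  -- Terms of λΠ_P, well-scoped de Bruijn syntax (n free variables in scope).
  -- Terms are thus identified up to α-equivalence.  The constants
  -- U_s, ε_s, ṡ₁ (⟨s₁,s₂⟩ ∈ A) and Π̇_⟨s₁,s₂,s₃⟩ (∈ R) are separate constructors.
  data Term (n : ℕ) : Set ℓ where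
    var   : Fin n → Term n
    Type  : Term n
    Kind  : Term n
    Π     : Term n → Term (suc n) → Term n
    lam   : Term n → Term (suc n) → Term n
    _·_   : Term n → Term n → Term n
    U     : Sort → Term n
    ε     : Sort → Term n
    dot   : (s₁ s₂ : Sort) → Axiom s₁ s₂ → Term n
    dotΠ  : (s₁ s₂ s₃ : Sort) → Rule s₁ s₂ s₃ → Term n

  infixl 7 _·_

  Ren : ℕ → ℕ → Set
  Ren m n = Fin m → Fin n

  liftR : ∀ {m n} → Ren m n → Ren (suc m) (suc n)
  liftR ρ zero    = zero
  liftR ρ (suc i) = suc (ρ i)

  rename : ∀ {m n} → Ren m n → Term m → Term n
  rename ρ (var i)          = var (ρ i)
  rename ρ Type             = Type
  rename ρ Kind             = Kind
  rename ρ (Π A B)          = Π (rename ρ A) (rename (liftR ρ) B)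
  rename ρ (lam A M)        = lam (rename ρ A) (rename (liftR ρ) M)
  rename ρ (M · N)          = rename ρ M · rename ρ N
  rename ρ (U s)            = U s
  rename ρ (ε s)            = ε s
  rename ρ (dot s₁ s₂ a)    = dot s₁ s₂ a
  rename ρ (dotΠ s₁ s₂ s₃ r) = dotΠ s₁ s₂ s₃ r

  weaken : ∀ {n} → Term n → Term (suc n)
  weaken = rename suc

  Sub : ℕ → ℕ → Set ℓ
  Sub m n = Fin m → Term n

  liftS : ∀ {m n} → Sub m n → Sub (suc m) (suc n)
  liftS σ zero    = var zero
  liftS σ (suc i) = weaken (σ i)

  subst : ∀ {m n} → Sub m n → Term m → Term n
  subst σ (var i)          = σ i
  subst σ Type             = Type
  subst σ Kind             = Kind
  subst σ (Π A B)          = Π (subst σ A) (subst (liftS σ) B)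
  subst σ (lam A M)        = lam (subst σ A) (subst (liftS σ) M)
  subst σ (M · N)          = subst σ M · subst σ N
  subst σ (U s)            = U s
  subst σ (ε s)            = ε s
  subst σ (dot s₁ s₂ a)    = dot s₁ s₂ a
  subst σ (dotΠ s₁ s₂ s₃ r) = dotΠ s₁ s₂ s₃ r

  -- single substitution (N/x)M, x = de Bruijn index 0
  single : ∀ {n} → Term n → Sub (suc n) n
  single N zero    = N
  single N (suc i) = var i

  _[_] : ∀ {n} → Term (suc n) → Term n → Term n
  M [ N ] = subst (single N) M

  infix 4 _⇛_
  data _⇛_ {n : ℕ} : Term n → Term n → Set ℓ where
    α  : ∀ {M} → M ⇛ M
    β  : ∀ {s₁ s₂} (a : Axiom s₁ s₂) → ε s₂ · dot s₁ s₂ a ⇛ U s₁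
    γ  : ∀ {A A' M M'} → A ⇛ A' → M ⇛ M' → lam A M ⇛ lam A' M'
    δ  : ∀ {A A' B B'} → A ⇛ A' → B ⇛ B' → Π A B ⇛ Π A' B'
    θ₁ : ∀ {M M' N N'} → M ⇛ M' → N ⇛ N' → M · N ⇛ M' · N'
    θ₂ : ∀ {A M M' N N'} → M ⇛ M' → N ⇛ N' → lam A M · N ⇛ M' [ N' ]
    η₁ : ∀ {s₁ s₂ s₃} {r : Rule s₁ s₂ s₃} {A A' B B'} → A ⇛ A' → B ⇛ B' →
         ε s₃ · (dotΠ s₁ s₂ s₃ r · A · B) ⇛ ε s₃ · (dotΠ s₁ s₂ s₃ r · A' · B')
    η₂ : ∀ {s₁ s₂ s₃} {r : Rule s₁ s₂ s₃} {A A' B B'} → A ⇛ A' → B ⇛ B' →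
         ε s₃ · (dotΠ s₁ s₂ s₃ r · A · B) ⇛ Π (ε s₁ · A') (ε s₂ · (weaken B' · var zero))

{-# OPTIONS --safe #-}
-- Tait–Martin-Löf: induct on both derivations.  The only non-trivial overlaps
-- are a redex (β, θ₂ or η₂) rewritten inside on one side and contracted on the
-- other; in each case both sides meet at the contractum of common reducts of
-- the redex's arguments.  For θ₂ this uses that ⇛ is stable under
-- substitution.  Takahashi's complete development is not available: whether
-- ε s · dot s₁ s₂ a is a redex depends on s ≡ s₂, which is undecidable for an
-- arbitrary type of sorts.
module Submission where

open import Defs
open import Level using (Level)
open import Data.Nat using (ℕ; suc)
open import Data.Fin using (zero; suc)
open import Data.Product using (Σ; ∃; ∃₂; _×_; _,_)
open import Function using (_∘_; id)
open import Relation.Binary.PropositionalEquality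
  using (_≡_; _≗_; refl; sym; trans; cong; cong₂)

module ParallelReduction {ℓ : Level} (P : PTS ℓ) where
  open PTS P
  open LambdaPi P

  private
    variable
      l m n : ℕ
      s₁ s₂ s₃ : Sort
      A A' B B' M M' M'' N N' X : Term n

  liftR-∘ : {ρ₁ : Ren m n} {ρ₂ : Ren l m} {ρ : Ren l n} →
    ρ₁ ∘ ρ₂ ≗ ρ → liftR ρ₁ ∘ liftR ρ₂ ≗ liftR ρ
  liftR-∘ h zero    = refl
  liftR-∘ h (suc i) = cong suc (h i)

  rename-rename : {ρ₁ : Ren m n} {ρ₂ : Ren l m} {ρ : Ren l n} →
    ρ₁ ∘ ρ₂ ≗ ρ → rename ρ₁ ∘ rename ρ₂ ≗ rename ρ
  rename-rename h (var i)          = cong var (h i)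
  rename-rename h Type             = refl
  rename-rename h Kind             = refl
  rename-rename h (Π A B)          = cong₂ Π (rename-rename h A) (rename-rename (liftR-∘ h) B)
  rename-rename h (lam A M)        = cong₂ lam (rename-rename h A) (rename-rename (liftR-∘ h) M)
  rename-rename h (M · N)          = cong₂ _·_ (rename-rename h M) (rename-rename h N)
  rename-rename h (U s)            = refl
  rename-rename h (ε s)            = refl
  rename-rename h (dot s₁ s₂ a)    = refl
  rename-rename h (dotΠ s₁ s₂ s₃ r) = refl

  rename-weaken : (ρ : Ren m n) (M : Term m) → rename (liftR ρ) (weaken M) ≡ weaken (rename ρ M)
  rename-weaken ρ M = trans (rename-rename (λ _ → refl) M) (sym (rename-rename (λ _ → refl) M))

  rename-liftS : {ρ : Ren m n} {σ : Sub l m} {τ : Sub l n} →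
    rename ρ ∘ σ ≗ τ → rename (liftR ρ) ∘ liftS σ ≗ liftS τ
  rename-liftS h zero    = refl
  rename-liftS {ρ = ρ} {σ} h (suc i) = trans (rename-weaken ρ (σ i)) (cong weaken (h i))

  rename-subst : {ρ : Ren m n} {σ : Sub l m} {τ : Sub l n} →
    rename ρ ∘ σ ≗ τ → rename ρ ∘ subst σ ≗ subst τ
  rename-subst h (var i)          = h i
  rename-subst h Type             = refl
  rename-subst h Kind             = refl
  rename-subst h (Π A B)          = cong₂ Π (rename-subst h A) (rename-subst (rename-liftS h) B)
  rename-subst h (lam A M)        = cong₂ lam (rename-subst h A) (rename-subst (rename-liftS h) M)
  rename-subst h (M · N)          = cong₂ _·_ (rename-subst h M) (rename-subst h N)
  rename-subst h (U s)            = refl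
  rename-subst h (ε s)            = refl
  rename-subst h (dot s₁ s₂ a)    = refl
  rename-subst h (dotΠ s₁ s₂ s₃ r) = refl

  liftS-liftR : {σ : Sub m n} {ρ : Ren l m} {τ : Sub l n} →
    σ ∘ ρ ≗ τ → liftS σ ∘ liftR ρ ≗ liftS τ
  liftS-liftR h zero    = refl
  liftS-liftR h (suc i) = cong weaken (h i)

  subst-rename : {σ : Sub m n} {ρ : Ren l m} {τ : Sub l n} →
    σ ∘ ρ ≗ τ → subst σ ∘ rename ρ ≗ subst τ
  subst-rename h (var i)          = h i
  subst-rename h Type             = refl
  subst-rename h Kind             = refl
  subst-rename h (Π A B)          = cong₂ Π (subst-rename h A) (subst-rename (liftS-liftR h) B)
  subst-rename h (lam A M)        = cong₂ lam (subst-rename h A) (subst-rename (liftS-liftR h) M)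
  subst-rename h (M · N)          = cong₂ _·_ (subst-rename h M) (subst-rename h N)
  subst-rename h (U s)            = refl
  subst-rename h (ε s)            = refl
  subst-rename h (dot s₁ s₂ a)    = refl
  subst-rename h (dotΠ s₁ s₂ s₃ r) = refl

  subst-weaken : (σ : Sub m n) (M : Term m) → subst (liftS σ) (weaken M) ≡ weaken (subst σ M)
  subst-weaken σ M = trans (subst-rename (λ _ → refl) M) (sym (rename-subst (λ _ → refl) M))

  subst-liftS : {σ : Sub m n} {τ : Sub l m} {υ : Sub l n} →
    subst σ ∘ τ ≗ υ → subst (liftS σ) ∘ liftS τ ≗ liftS υ
  subst-liftS h zero    = refl
  subst-liftS {σ = σ} {τ} h (suc i) = trans (subst-weaken σ (τ i)) (cong weaken (h i))

  subst-subst : {σ : Sub m n} {τ : Sub l m} {υ : Sub l n} →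
    subst σ ∘ τ ≗ υ → subst σ ∘ subst τ ≗ subst υ
  subst-subst h (var i)          = h i
  subst-subst h Type             = refl
  subst-subst h Kind             = refl
  subst-subst h (Π A B)          = cong₂ Π (subst-subst h A) (subst-subst (subst-liftS h) B)
  subst-subst h (lam A M)        = cong₂ lam (subst-subst h A) (subst-subst (subst-liftS h) M)
  subst-subst h (M · N)          = cong₂ _·_ (subst-subst h M) (subst-subst h N)
  subst-subst h (U s)            = refl
  subst-subst h (ε s)            = refl
  subst-subst h (dot s₁ s₂ a)    = refl
  subst-subst h (dotΠ s₁ s₂ s₃ r) = refl

  liftS-var : {σ : Sub n n} → σ ≗ var → liftS σ ≗ var
  liftS-var h zero    = refl
  liftS-var h (suc i) = cong weaken (h i)

  subst-var : {σ : Sub n n} → σ ≗ var → subst σ ≗ id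
  subst-var h (var i)          = h i
  subst-var h Type             = refl
  subst-var h Kind             = refl
  subst-var h (Π A B)          = cong₂ Π (subst-var h A) (subst-var (liftS-var h) B)
  subst-var h (lam A M)        = cong₂ lam (subst-var h A) (subst-var (liftS-var h) M)
  subst-var h (M · N)          = cong₂ _·_ (subst-var h M) (subst-var h N)
  subst-var h (U s)            = refl
  subst-var h (ε s)            = refl
  subst-var h (dot s₁ s₂ a)    = refl
  subst-var h (dotΠ s₁ s₂ s₃ r) = refl

  weaken-[] : (M N : Term n) → weaken M [ N ] ≡ M
  weaken-[] M N = trans (subst-rename (λ _ → refl) M) (subst-var (λ _ → refl) M)

  rename-[] : (ρ : Ren m n) (M : Term (suc m)) (N : Term m) →
    rename ρ (M [ N ]) ≡ rename (liftR ρ) M [ rename ρ N ]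
  rename-[] ρ M N = trans (rename-subst single-rename M) (sym (subst-rename (λ _ → refl) M))
    where
    single-rename : rename ρ ∘ single N ≗ single (rename ρ N) ∘ liftR ρ
    single-rename zero    = refl
    single-rename (suc i) = refl

  subst-[] : (σ : Sub m n) (M : Term (suc m)) (N : Term m) →
    subst σ (M [ N ]) ≡ subst (liftS σ) M [ subst σ N ]
  subst-[] σ M N = trans (subst-subst (λ _ → refl) M) (sym (subst-subst single-liftS M))
    where
    single-liftS : subst (single (subst σ N)) ∘ liftS σ ≗ subst σ ∘ single N
    single-liftS zero    = refl
    single-liftS (suc i) = weaken-[] (σ i) (subst σ N)

  rename-⇛ : (ρ : Ren m n) → M ⇛ M' → rename ρ M ⇛ rename ρ M'
  rename-⇛ ρ α        = α
  rename-⇛ ρ (β a)    = β a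
  rename-⇛ ρ (γ a m)  = γ (rename-⇛ ρ a) (rename-⇛ (liftR ρ) m)
  rename-⇛ ρ (δ a b)  = δ (rename-⇛ ρ a) (rename-⇛ (liftR ρ) b)
  rename-⇛ ρ (θ₁ m n) = θ₁ (rename-⇛ ρ m) (rename-⇛ ρ n)
  rename-⇛ ρ (θ₂ {M' = M'} {N' = N'} m n) rewrite rename-[] ρ M' N' =
    θ₂ (rename-⇛ (liftR ρ) m) (rename-⇛ ρ n)
  rename-⇛ ρ (η₁ a b) = η₁ (rename-⇛ ρ a) (rename-⇛ ρ b)
  rename-⇛ ρ (η₂ {B' = B'} a b) rewrite rename-weaken ρ B' =
    η₂ (rename-⇛ ρ a) (rename-⇛ ρ b)

  infix 4 _⇛ₛ_
  _⇛ₛ_ : Sub m n → Sub m n → Set ℓ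
  σ ⇛ₛ σ' = ∀ i → σ i ⇛ σ' i

  liftS-⇛ₛ : {σ σ' : Sub m n} → σ ⇛ₛ σ' → liftS σ ⇛ₛ liftS σ'
  liftS-⇛ₛ h zero    = α
  liftS-⇛ₛ h (suc i) = rename-⇛ suc (h i)

  subst-⇛ₛ : {σ σ' : Sub m n} → σ ⇛ₛ σ' → (M : Term m) → subst σ M ⇛ subst σ' M
  subst-⇛ₛ h (var i)          = h i
  subst-⇛ₛ h Type             = α
  subst-⇛ₛ h Kind             = α
  subst-⇛ₛ h (Π A B)          = δ (subst-⇛ₛ h A) (subst-⇛ₛ (liftS-⇛ₛ h) B)
  subst-⇛ₛ h (lam A M)        = γ (subst-⇛ₛ h A) (subst-⇛ₛ (liftS-⇛ₛ h) M)
  subst-⇛ₛ h (M · N)          = θ₁ (subst-⇛ₛ h M) (subst-⇛ₛ h N)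
  subst-⇛ₛ h (U s)            = α
  subst-⇛ₛ h (ε s)            = α
  subst-⇛ₛ h (dot s₁ s₂ a)    = α
  subst-⇛ₛ h (dotΠ s₁ s₂ s₃ r) = α

  subst-⇛ : {σ σ' : Sub m n} → σ ⇛ₛ σ' → M ⇛ M' → subst σ M ⇛ subst σ' M'
  subst-⇛ h (α {M})  = subst-⇛ₛ h M
  subst-⇛ h (β a)    = β a
  subst-⇛ h (γ a m)  = γ (subst-⇛ h a) (subst-⇛ (liftS-⇛ₛ h) m)
  subst-⇛ h (δ a b)  = δ (subst-⇛ h a) (subst-⇛ (liftS-⇛ₛ h) b)
  subst-⇛ h (θ₁ m n) = θ₁ (subst-⇛ h m) (subst-⇛ h n)
  subst-⇛ {σ' = σ'} h (θ₂ {M' = M'} {N' = N'} m n) rewrite subst-[] σ' M' N' =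
    θ₂ (subst-⇛ (liftS-⇛ₛ h) m) (subst-⇛ h n)
  subst-⇛ h (η₁ a b) = η₁ (subst-⇛ h a) (subst-⇛ h b)
  subst-⇛ {σ' = σ'} h (η₂ {B' = B'} a b) rewrite subst-weaken σ' B' =
    η₂ (subst-⇛ h a) (subst-⇛ h b)

  []-⇛ : {M M' : Term (suc n)} → M ⇛ M' → N ⇛ N' → M [ N ] ⇛ M' [ N' ]
  []-⇛ {N = N} {N'} m n = subst-⇛ single-⇛ₛ m
    where
    single-⇛ₛ : single N ⇛ₛ single N'
    single-⇛ₛ zero    = n
    single-⇛ₛ (suc i) = α

  ηContractum : Sort → Sort → Term n → Term n → Term n
  ηContractum s₁ s₂ A B = Π (ε s₁ · A) (ε s₂ · (weaken B · var zero))

  ηContractum-⇛ : A ⇛ A' → B ⇛ B' →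
    ηContractum s₁ s₂ A B ⇛ ηContractum s₁ s₂ A' B'
  ηContractum-⇛ a b = δ (θ₁ α a) (θ₁ α (θ₁ (rename-⇛ suc b) α))

  β-redex-⇛ : {a : Axiom s₁ s₂} → ε {n} s₂ · dot s₁ s₂ a ⇛ X → X ⇛ U s₁
  β-redex-⇛ α        = β _
  β-redex-⇛ (θ₁ α α) = β _
  β-redex-⇛ (β a)    = α

  diamond : M ⇛ M' → M ⇛ M'' → ∃ λ N → M' ⇛ N × M'' ⇛ N

  θ₂-redex-join : {M M' : Term (suc n)} → lam A M · N ⇛ X → M ⇛ M' → N ⇛ N' →
    ∃₂ λ M* N* → X ⇛ M* [ N* ] × M' ⇛ M* × N' ⇛ N*

  η₂-redex-join : {r : Rule s₁ s₂ s₃} →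
    ε s₃ · (dotΠ s₁ s₂ s₃ r · A · B) ⇛ X → A ⇛ A' → B ⇛ B' →
    ∃₂ λ A* B* → X ⇛ ηContractum s₁ s₂ A* B* × A' ⇛ A* × B' ⇛ B*

  diamond α e = _ , e , α
  diamond d α = _ , α , d
  diamond d (β a) = _ , β-redex-⇛ d , α
  diamond (β a) e = _ , α , β-redex-⇛ e
  diamond d (θ₂ m n) =
    let _ , _ , d⇛ , m⇛ , n⇛ = θ₂-redex-join d m n in _ , d⇛ , []-⇛ m⇛ n⇛
  diamond (θ₂ m n) e =
    let _ , _ , e⇛ , m⇛ , n⇛ = θ₂-redex-join e m n in _ , []-⇛ m⇛ n⇛ , e⇛
  diamond d (η₁ a b) =
    let _ , _ , d⇛ , a⇛ , b⇛ = η₂-redex-join d a b in _ , d⇛ , η₂ a⇛ b⇛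
  diamond d (η₂ a b) =
    let _ , _ , d⇛ , a⇛ , b⇛ = η₂-redex-join d a b in _ , d⇛ , ηContractum-⇛ a⇛ b⇛
  diamond (η₁ a b) e =
    let _ , _ , e⇛ , a⇛ , b⇛ = η₂-redex-join e a b in _ , η₂ a⇛ b⇛ , e⇛
  diamond (η₂ a b) e =
    let _ , _ , e⇛ , a⇛ , b⇛ = η₂-redex-join e a b in _ , ηContractum-⇛ a⇛ b⇛ , e⇛
  diamond (γ a₁ m₁) (γ a₂ m₂) =
    let _ , a₁⇛ , a₂⇛ = diamond a₁ a₂ ; _ , m₁⇛ , m₂⇛ = diamond m₁ m₂ in
    _ , γ a₁⇛ m₁⇛ , γ a₂⇛ m₂⇛
  diamond (δ a₁ b₁) (δ a₂ b₂) =
    let _ , a₁⇛ , a₂⇛ = diamond a₁ a₂ ; _ , b₁⇛ , b₂⇛ = diamond b₁ b₂ in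
    _ , δ a₁⇛ b₁⇛ , δ a₂⇛ b₂⇛
  diamond (θ₁ m₁ n₁) (θ₁ m₂ n₂) =
    let _ , m₁⇛ , m₂⇛ = diamond m₁ m₂ ; _ , n₁⇛ , n₂⇛ = diamond n₁ n₂ in
    _ , θ₁ m₁⇛ n₁⇛ , θ₁ m₂⇛ n₂⇛

  θ₂-redex-join α m n = _ , _ , θ₂ m n , α , α
  θ₂-redex-join (θ₁ α n₀) m n =
    let _ , n₀⇛ , n⇛ = diamond n₀ n in _ , _ , θ₂ m n₀⇛ , α , n⇛
  θ₂-redex-join (θ₁ (γ _ m₀) n₀) m n =
    let _ , m₀⇛ , m⇛ = diamond m₀ m ; _ , n₀⇛ , n⇛ = diamond n₀ n in
    _ , _ , θ₂ m₀⇛ n₀⇛ , m⇛ , n⇛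
  θ₂-redex-join (θ₂ m₀ n₀) m n =
    let _ , m₀⇛ , m⇛ = diamond m₀ m ; _ , n₀⇛ , n⇛ = diamond n₀ n in
    _ , _ , []-⇛ m₀⇛ n₀⇛ , m⇛ , n⇛

  η₂-redex-join α a b = _ , _ , η₂ a b , α , α
  η₂-redex-join (θ₁ α α) a b = _ , _ , η₂ a b , α , α
  η₂-redex-join (θ₁ α (θ₁ α b₀)) a b =
    let _ , b₀⇛ , b⇛ = diamond b₀ b in _ , _ , η₂ a b₀⇛ , α , b⇛
  η₂-redex-join (θ₁ α (θ₁ (θ₁ α a₀) b₀)) a b =
    let _ , a₀⇛ , a⇛ = diamond a₀ a ; _ , b₀⇛ , b⇛ = diamond b₀ b in
    _ , _ , η₂ a₀⇛ b₀⇛ , a⇛ , b⇛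
  η₂-redex-join (η₁ a₀ b₀) a b =
    let _ , a₀⇛ , a⇛ = diamond a₀ a ; _ , b₀⇛ , b⇛ = diamond b₀ b in
    _ , _ , η₂ a₀⇛ b₀⇛ , a⇛ , b⇛
  η₂-redex-join (η₂ a₀ b₀) a b =
    let _ , a₀⇛ , a⇛ = diamond a₀ a ; _ , b₀⇛ , b⇛ = diamond b₀ b in
    _ , _ , ηContractum-⇛ a₀⇛ b₀⇛ , a⇛ , b⇛

proposition8 : {ℓ : Level} (P : PTS ℓ) → let open LambdaPi P in
    ∀ {n : ℕ} (M M' M'' : Term n) → M ⇛ M' → M ⇛ M'' →
    Σ (Term n) (λ N → (M' ⇛ N) × (M'' ⇛ N))
proposition8 P M M' M'' = ParallelReduction.diamond P
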